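{- Let $\mathscr{A}$ be a closed set of impartial games whose misère quotient $(\mathcal{Q},\mathcal{P})$ is finite and regular, and whose quotient map $\Phi:\mathscr{A}\to\mathcal{Q}$ is faithful. Let $\mathcal{K}$ be the kernel of $\mathcal{Q}$ and let $z$ be the identity of $\mathcal{K}$. Then for all $G,H\in\mathscr{A}$, \[z\Phi(G)=z\Phi(H)\iff G \text{ and } H \text{ have the same normal-play Grundy value}.\]
   Context: All games are impartial; $G+H$ denotes the disjunctive sum. In misère play the player who makes the last move loses; $o^-(G)\in\{\mathscr{P},\mathscr{N}\}$ denotes the misère outcome ($\mathscr{P}$ if the player not to move can force a win, $\mathscr{N}$ otherwise). A set $\mathscr{A}$ of games is closed if it is closed under disjunctive sum and every option of a member of $\mathscr{A}$ is in $\mathscr{A}$. For closed $\mathscr{A}$ and $G,H\in\mathscr{A}$ write $G\equiv_{\mathscr{A}}H$ iff $o^-(G+X)=o^-(H+X)$ for every $X\in\mathscr{A}$; this is a congruence, $\mathcal{Q}=\mathscr{A}/\equiv_{\mathscr{A}}$ is a commutative monoid, $\Phi:\mathscr{A}\to\mathcal{Q}$ is the quotient map, and $\mathcal{P}=\{\Phi(G):G\in\mathscr{A},\ o^-(G)=\mathscr{P}\}$. The pair $(\mathcal{Q},\mathcal{P})$ is the misère quotient of $\mathscr{A}$. For a finite commutative monoid $\mathcal{Q}$: $x$ divides $y$ if $xw=y$ for some $w\in\mathcal{Q}$; $z$ is the product of all idempotents ($e^2=e$) of $\mathcal{Q}$, and the kernel $\mathcal{K}$ is the set of $x\in\mathcal{Q}$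 with $x\mid z$ and $z\mid x$; it is a group with identity $z$. The finite quotient $(\mathcal{Q},\mathcal{P})$ is regular if $|\mathcal{K}\cap\mathcal{P}|=1$. The quotient map $\Phi$ is faithful if $\Phi(G)=\Phi(H)$ implies that $G$ and $H$ have the same normal-play (Sprague–Grundy) value. -}

module Defs where

open import Data.Nat using (ℕ; zero; suc)
open import Data.Nat.Properties using () renaming (_≟_ to _≟ℕ_)
open import Data.Bool using (Bool; true; false; not; _∧_; if_then_else_)
open import Data.List using (List; []; _∷_; _++_; foldr; filter; length)
open import Data.List.Membership.DecPropositional _≟ℕ_ using (_∈?_)
open import Data.Fin using (Fin) renaming (_≟_ to _≟F_)
open import Data.List using (allFin)
open import Data.Product using (Σ; ∃; _×_; _,_)
open import Relation.Nullary using (does)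
open import Data.List.Membership.Propositional using (_∈_)
open import Relation.Binary.PropositionalEquality using (_≡_)

data Game : Set where
  node : List Game → Game

options : Game → List Game
options (node gs) = gs

𝟘 : Game
𝟘 = node []

mutual
  infixl 6 _⊕_
  _⊕_ : Game → Game → Game
  G@(node gs) ⊕ H@(node hs) = node (sumL gs H ++ sumR G hs)

  sumL : List Game → Game → List Game
  sumL [] H = []
  sumL (g ∷ gs) H = (g ⊕ H) ∷ sumL gs H

  sumR : Game → List Game → List Game
  sumR G [] = []
  sumR G (h ∷ hs) = (G ⊕ h) ∷ sumR G hs

-- Misère outcome: a position with no options is an 𝒩-position (the
-- player to move cannot move, so the opponent moved last and loses);
-- otherwise it is 𝒫 iff every option is 𝒩.

data Outcome : Set where
  𝒫 𝒩 : Outcome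

mutual
  misereP : Game → Bool
  misereP (node []) = false
  misereP (node (g ∷ gs)) = allN (g ∷ gs)

  allN : List Game → Bool
  allN [] = true
  allN (g ∷ gs) = not (misereP g) ∧ allN gs

o⁻ : Game → Outcome
o⁻ G = if misereP G then 𝒫 else 𝒩

mexAux : List ℕ → ℕ → ℕ → ℕ
mexAux l n zero = n
mexAux l n (suc k) = if does (n ∈? l) then mexAux l (suc n) k else n

-- minimum excluded natural number (always ≤ length l)
mex : List ℕ → ℕ
mex l = mexAux l 0 (suc (length l))

mutual
  grundy : Game → ℕ
  grundy (node gs) = mex (grundys gs)

  grundys : List Game → List ℕ
  grundys [] = []
  grundys (g ∷ gs) = grundy g ∷ grundys gs

record Closed (𝒜 : Game → Set) : Set where
  field
    sum-closed    : ∀ {G H} → 𝒜 G → 𝒜 H → 𝒜 (G ⊕ H)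
    option-closed : ∀ {G G'} → 𝒜 G → G' ∈ options G → 𝒜 G'

_≡[_]_ : Game → (Game → Set) → Game → Set
G ≡[ 𝒜 ] H = ∀ X → 𝒜 X → o⁻ (G ⊕ X) ≡ o⁻ (H ⊕ X)

-- A presentation of the misère quotient of 𝒜 with n elements consists of
-- a binary operation and unit on Fin n and a map Φ from 𝒜 onto Fin n
-- whose fibres are exactly the ≡[ 𝒜 ]-classes and which turns ⊕ into
-- the operation.  Then (Fin n, _·_, ε) is (isomorphic to) 𝒜 / ≡[ 𝒜 ].

record MisereQuotient (𝒜 : Game → Set) (n : ℕ) : Set where
  field
    _·_        : Fin n → Fin n → Fin n
    ε          : Fin n
    Φ          : (G : Game) → 𝒜 G → Fin n
    Φ-surj     : ∀ q → Σ Game λ G → Σ (𝒜 G) λ a → Φ G a ≡ q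
    Φ-kernel→  : ∀ G H (a : 𝒜 G) (b : 𝒜 H) → Φ G a ≡ Φ H b → G ≡[ 𝒜 ] H
    Φ-kernel←  : ∀ G H (a : 𝒜 G) (b : 𝒜 H) → G ≡[ 𝒜 ] H → Φ G a ≡ Φ H b
    Φ-hom      : ∀ G H (a : 𝒜 G) (b : 𝒜 H) (c : 𝒜 (G ⊕ H)) →
                 Φ (G ⊕ H) c ≡ (Φ G a · Φ H b)
    ε-identity : ∀ x → (ε · x) ≡ x

  infixl 7 _·_

  𝓟 : Fin n → Set
  𝓟 q = Σ Game λ G → Σ (𝒜 G) λ a → (Φ G a ≡ q) × (o⁻ G ≡ 𝒫)

  _∣_ : Fin n → Fin n → Set
  x ∣ y = Σ (Fin n) λ w → (x · w) ≡ y

  z : Fin n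
  z = foldr _·_ ε (filter (λ e → (e · e) ≟F e) (allFin n))

  𝒦 : Fin n → Set
  𝒦 x = (x ∣ z) × (z ∣ x)

  Regular : Set
  Regular = Σ (Fin n) λ k → (𝒦 k × 𝓟 k) × (∀ k' → 𝒦 k' → 𝓟 k' → k' ≡ k)

  Faithful : Set
  Faithful = ∀ G H (a : 𝒜 G) (b : 𝒜 H) → Φ G a ≡ Φ H b → grundy G ≡ grundy H

-- Multiplication by z maps the quotient onto its kernel 𝒦, a group, and z · Φ G = Φ (G ⊕ W) for
-- any W with Φ W = z. Since 𝒢 (G ⊕ W) = 𝒢 (H ⊕ W) iff 𝒢 G = 𝒢 H for normal-play Grundy values 𝒢,
-- it suffices that games X, X′ with images in 𝒦 have Φ X = Φ X′ iff 𝒢 X = 𝒢 X′. Faithfulness is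
-- one direction. For the other, regularity gives 𝒦 ∩ 𝓟 = {Φ T} for a misère 𝒫-position T. A game
-- with image in 𝒦, whose options all have images in 𝒦 and with 𝒢 equal to 𝒢 T, is a 𝒫-position:
-- a 𝒫-option would map to Φ T, hence by faithfulness share its Grundy value. Adding to X and X′ a
-- game built from T that moves X′ to Φ T reduces the general case to this one.

module Submission where

open import Defs
open import Algebra.Bundles using (CommutativeMonoid)
open import Algebra.Core using (Op₂)
open import Algebra.Structures using (IsCommutativeMonoid)
open import Algebra.Structures.Biased using (isCommutativeMonoidˡ)
open import Data.Bool using (true; false; if_then_else_) renaming (_≟_ to _≟ᵇ_)
open import Data.Bool.Properties using (⇔→≡; ¬-not)
open import Data.Fin using (Fin; toℕ) renaming (_≟_ to _≟F_)
open import Data.Fin.Properties using (pigeonhole; toℕ<n)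
open import Data.List using ([]; _∷_; _++_; map; foldr; filter; allFin; length; lookup)
open import Data.List.Membership.Propositional using (_∈_; _∉_; find)
open import Data.List.Membership.Propositional.Properties
  using (∈-map⁺; ∈-map⁻; ∈-++⁺ˡ; ∈-++⁺ʳ; ∈-++⁻; ∈-filter⁺; ∈-allFin)
open import Data.Nat using (ℕ; zero; suc; _+_; _*_; _<_; _≤_; _≤?_; _≟_; s≤s)
open import Data.List.Membership.DecPropositional _≟_ using (_∈?_)
open import Data.List.Relation.Unary.All as All using (All; []; _∷_)
open import Data.List.Relation.Unary.All.Properties using (all-filter; ¬All⇒Any¬)
open import Data.List.Relation.Unary.Any using (here; there; index)
open import Data.List.Relation.Unary.Any.Properties using (lookup-index)
open import Data.Nat.Properties
  using (<-cmp; <-irrefl; <⇒≢; +-identityʳ; +-suc; +-assoc; *-suc; n<1+n; ≰⇒>;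
         m≤n⇒m<n∨m≡n; m≤n⇒∃[o]m+o≡n)
open import Data.Product using (∃-syntax; _×_; _,_; proj₁; proj₂)
open import Data.Sum using (_⊎_; inj₁; inj₂)
open import Function using (_∘_)
open import Function.Bundles using (_⇔_; mk⇔; Equivalence)
open import Function.Properties.Equivalence using (⇔-setoid)
open import Induction.WellFounded using (WellFounded; Acc; acc)
open import Level using (0ℓ)
open import Relation.Binary.Core using (Rel)
open import Relation.Binary.Definitions using (tri<; tri≈; tri>)
open import Relation.Binary.PropositionalEquality
  using (_≡_; _≢_; refl; sym; trans; cong; cong₂; subst; isEquivalence; module ≡-Reasoning)
open import Relation.Nullary using (yes; no; contradiction)
open import Relation.Nullary.Decidable using (decidable-stable)
import Algebra.Definitions
import Algebra.Properties.CommutativeSemigroup as CommutativeSemigroupProperties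
import Algebra.Properties.Monoid.Mult as MonoidMult
import Relation.Binary.Reasoning.Setoid as SetoidReasoning

open Equivalence using (to; from)

≡-resp-⇔ : ∀ {A : Set} {x x′ y y′ : A} → x ≡ x′ → y ≡ y′ → (x ≡ y) ⇔ (x′ ≡ y′)
≡-resp-⇔ refl refl = mk⇔ (λ e → e) (λ e → e)

infix 4 _≺_ _≅_

_≺_ : Rel Game 0ℓ
g ≺ G = g ∈ options G

sumL≡map : ∀ gs H → sumL gs H ≡ map (_⊕ H) gs
sumL≡map []       H = refl
sumL≡map (g ∷ gs) H = cong (g ⊕ H ∷_) (sumL≡map gs H)

sumR≡map : ∀ G hs → sumR G hs ≡ map (G ⊕_) hs
sumR≡map G []       = refl
sumR≡map G (h ∷ hs) = cong (G ⊕ h ∷_) (sumR≡map G hs)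

options-⊕ : ∀ G H → options (G ⊕ H) ≡ map (_⊕ H) (options G) ++ map (G ⊕_) (options H)
options-⊕ G@(node gs) H@(node hs) = cong₂ _++_ (sumL≡map gs H) (sumR≡map G hs)

≺-⊕ˡ : ∀ {g} G H → g ≺ G → g ⊕ H ≺ G ⊕ H
≺-⊕ˡ G H g≺G = subst (_ ∈_) (sym (options-⊕ G H)) (∈-++⁺ˡ (∈-map⁺ (_⊕ H) g≺G))

≺-⊕ʳ : ∀ {h} G H → h ≺ H → G ⊕ h ≺ G ⊕ H
≺-⊕ʳ G H h≺H = subst (_ ∈_) (sym (options-⊕ G H)) (∈-++⁺ʳ _ (∈-map⁺ (G ⊕_) h≺H))

data ⊕-View (G H : Game) : Game → Set where
  left  : ∀ {g} → g ≺ G → ⊕-View G H (g ⊕ H)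
  right : ∀ {h} → h ≺ H → ⊕-View G H (G ⊕ h)

⊕-view : ∀ G H {x} → x ≺ G ⊕ H → ⊕-View G H x
⊕-view G H x≺G⊕H with ∈-++⁻ (map (_⊕ H) (options G)) (subst (_ ∈_) (options-⊕ G H) x≺G⊕H)
... | inj₁ x∈ with ∈-map⁻ (_⊕ H) x∈
...   | g , g≺G , refl = left g≺G
⊕-view G H _ | inj₂ x∈ with ∈-map⁻ (G ⊕_) x∈
...   | h , h≺H , refl = right h≺H

mutual
  ≺-wellFounded : WellFounded _≺_
  ≺-wellFounded (node gs) = acc (∈-accessible gs)

  ∈-accessible : ∀ gs {g} → g ∈ gs → Acc _≺_ g
  ∈-accessible (g ∷ gs) (here refl)  = ≺-wellFounded g
  ∈-accessible (g ∷ gs) (there g∈gs) = ∈-accessible gs g∈gs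

-- Equality of game trees up to the order and multiplicity of options; ⊕ is a commutative
-- monoid only up to ≅.
data _≅_ : Game → Game → Set where
  bisim : ∀ {G H} →
          (∀ {g} → g ≺ G → ∃[ h ] h ≺ H × g ≅ h) →
          (∀ {h} → h ≺ H → ∃[ g ] g ≺ G × g ≅ h) → G ≅ H

≅-refl : ∀ G → G ≅ G
≅-refl G = go (≺-wellFounded G)
  where
  go : ∀ {G} → Acc _≺_ G → G ≅ G
  go (acc rs) = bisim (λ g≺G → _ , g≺G , go (rs g≺G)) (λ h≺H → _ , h≺H , go (rs h≺H))

≅-sym : ∀ {G H} → G ≅ H → H ≅ G
≅-sym (bisim forth back) =
  bisim (λ h≺H → let g , g≺G , g≅h = back h≺H in g , g≺G , ≅-sym g≅h)
        (λ g≺G → let h , h≺H , g≅h = forth g≺G in h , h≺H , ≅-sym g≅h)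

≅-trans : ∀ {G H K} → G ≅ H → H ≅ K → G ≅ K
≅-trans (bisim forth back) (bisim forth′ back′) =
  bisim (λ g≺G → let h , h≺H , g≅h = forth g≺G ; k , k≺K , h≅k = forth′ h≺H
                 in k , k≺K , ≅-trans g≅h h≅k)
        (λ k≺K → let h , h≺H , h≅k = back′ k≺K ; g , g≺G , g≅h = back h≺H
                 in g , g≺G , ≅-trans g≅h h≅k)

mutual
  ⊕-cong : ∀ {G G′ H H′} → G ≅ G′ → H ≅ H′ → G ⊕ H ≅ G′ ⊕ H′
  ⊕-cong {G} {G′} {H} {H′} G≅G′ H≅H′ =
    bisim (λ x≺ → ⊕-cong-forth G≅G′ H≅H′ (⊕-view G H x≺))
          (λ y≺ → ⊕-cong-back G≅G′ H≅H′ (⊕-view G′ H′ y≺))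

  ⊕-cong-forth : ∀ {G G′ H H′ x} → G ≅ G′ → H ≅ H′ → ⊕-View G H x → ∃[ y ] y ≺ G′ ⊕ H′ × x ≅ y
  ⊕-cong-forth {G′ = G′} {H′ = H′} (bisim forth _) H≅H′ (left g≺G) =
    let g′ , g′≺G′ , g≅g′ = forth g≺G in g′ ⊕ H′ , ≺-⊕ˡ G′ H′ g′≺G′ , ⊕-cong g≅g′ H≅H′
  ⊕-cong-forth {G′ = G′} {H′ = H′} G≅G′ (bisim forth _) (right h≺H) =
    let h′ , h′≺H′ , h≅h′ = forth h≺H in G′ ⊕ h′ , ≺-⊕ʳ G′ H′ h′≺H′ , ⊕-cong G≅G′ h≅h′

  ⊕-cong-back : ∀ {G G′ H H′ y} → G ≅ G′ → H ≅ H′ → ⊕-View G′ H′ y → ∃[ x ] x ≺ G ⊕ H × x ≅ y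
  ⊕-cong-back {G} {H = H} (bisim _ back) H≅H′ (left g′≺G′) =
    let g , g≺G , g≅g′ = back g′≺G′ in g ⊕ H , ≺-⊕ˡ G H g≺G , ⊕-cong g≅g′ H≅H′
  ⊕-cong-back {G} {H = H} G≅G′ (bisim _ back) (right h′≺H′) =
    let h , h≺H , h≅h′ = back h′≺H′ in G ⊕ h , ≺-⊕ʳ G H h≺H , ⊕-cong G≅G′ h≅h′

⊕-comm : ∀ G H → G ⊕ H ≅ H ⊕ G
⊕-comm G H = go (≺-wellFounded G) (≺-wellFounded H)
  where
  go : ∀ {G H} → Acc _≺_ G → Acc _≺_ H → G ⊕ H ≅ H ⊕ G
  go {G} {H} aG@(acc rG) aH@(acc rH) = bisim (forth ∘ ⊕-view G H) (back ∘ ⊕-view H G)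
    where
    forth : ∀ {x} → ⊕-View G H x → ∃[ y ] y ≺ H ⊕ G × x ≅ y
    forth (left  g≺G) = H ⊕ _ , ≺-⊕ʳ H G g≺G , go (rG g≺G) aH
    forth (right h≺H) = _ ⊕ G , ≺-⊕ˡ H G h≺H , go aG (rH h≺H)
    back : ∀ {y} → ⊕-View H G y → ∃[ x ] x ≺ G ⊕ H × x ≅ y
    back (left  h≺H) = G ⊕ _ , ≺-⊕ʳ G H h≺H , go aG (rH h≺H)
    back (right g≺G) = _ ⊕ H , ≺-⊕ˡ G H g≺G , go (rG g≺G) aH

⊕-assoc : ∀ G H K → (G ⊕ H) ⊕ K ≅ G ⊕ (H ⊕ K)
⊕-assoc G H K = go (≺-wellFounded G) (≺-wellFounded H) (≺-wellFounded K)
  where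
  go : ∀ {G H K} → Acc _≺_ G → Acc _≺_ H → Acc _≺_ K → (G ⊕ H) ⊕ K ≅ G ⊕ (H ⊕ K)
  go {G} {H} {K} aG@(acc rG) aH@(acc rH) aK@(acc rK) =
    bisim (forth ∘ ⊕-view (G ⊕ H) K) (back ∘ ⊕-view G (H ⊕ K))
    where
    forth : ∀ {x} → ⊕-View (G ⊕ H) K x → ∃[ y ] y ≺ G ⊕ (H ⊕ K) × x ≅ y
    forth (left x≺G⊕H) with ⊕-view G H x≺G⊕H
    ... | left  g≺G = _ ⊕ (H ⊕ K) , ≺-⊕ˡ G (H ⊕ K) g≺G , go (rG g≺G) aH aK
    ... | right h≺H = G ⊕ (_ ⊕ K) , ≺-⊕ʳ G (H ⊕ K) (≺-⊕ˡ H K h≺H) , go aG (rH h≺H) aK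
    forth (right k≺K) = G ⊕ (H ⊕ _) , ≺-⊕ʳ G (H ⊕ K) (≺-⊕ʳ H K k≺K) , go aG aH (rK k≺K)
    back : ∀ {y} → ⊕-View G (H ⊕ K) y → ∃[ x ] x ≺ (G ⊕ H) ⊕ K × x ≅ y
    back (left g≺G) = (_ ⊕ H) ⊕ K , ≺-⊕ˡ (G ⊕ H) K (≺-⊕ˡ G H g≺G) , go (rG g≺G) aH aK
    back (right y≺H⊕K) with ⊕-view H K y≺H⊕K
    ... | left  h≺H = (G ⊕ _) ⊕ K , ≺-⊕ˡ (G ⊕ H) K (≺-⊕ʳ G H h≺H) , go aG (rH h≺H) aK
    ... | right k≺K = (G ⊕ H) ⊕ _ , ≺-⊕ʳ (G ⊕ H) K k≺K , go aG aH (rK k≺K)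

⊕-interchange : ∀ A B C D → (A ⊕ B) ⊕ (C ⊕ D) ≅ (A ⊕ C) ⊕ (B ⊕ D)
⊕-interchange A B C D =
  ≅-trans (⊕-assoc A B (C ⊕ D))
  (≅-trans (⊕-cong (≅-refl A) (≅-sym (⊕-assoc B C D)))
  (≅-trans (⊕-cong (≅-refl A) (⊕-cong (⊕-comm B C) (≅-refl D)))
  (≅-trans (⊕-cong (≅-refl A) (⊕-assoc C B D))
           (≅-sym (⊕-assoc A C (B ⊕ D))))))

DeterminedByOptions : {A : Set} → (Game → A) → Set
DeterminedByOptions f = ∀ G H →
  (∀ {g} → g ≺ G → ∃[ h ] h ≺ H × f g ≡ f h) →
  (∀ {h} → h ≺ H → ∃[ g ] g ≺ G × f g ≡ f h) → f G ≡ f H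

≅-invariant : ∀ {A : Set} (f : Game → A) → DeterminedByOptions f → ∀ {G H} → G ≅ H → f G ≡ f H
≅-invariant f det (bisim forth back) =
  det _ _ (λ g≺G → let h , h≺H , g≅h = forth g≺G in h , h≺H , ≅-invariant f det g≅h)
          (λ h≺H → let g , g≺G , g≅h = back h≺H in g , g≺G , ≅-invariant f det g≅h)

allN≡true⇔ : ∀ gs → allN gs ≡ true ⇔ All (λ g → misereP g ≡ false) gs
allN≡true⇔ [] = mk⇔ (λ _ → []) (λ _ → refl)
allN≡true⇔ (g ∷ gs) with misereP g in eq
... | true  = mk⇔ (λ ()) (λ { (g𝒩 ∷ _) → contradiction (trans (sym eq) g𝒩) λ () })
... | false = mk⇔ (λ gs𝒩 → eq ∷ to (allN≡true⇔ gs) gs𝒩) (λ { (_ ∷ gs𝒩) → from (allN≡true⇔ gs) gs𝒩 })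

misereP-determinedByOptions : DeterminedByOptions misereP
misereP-determinedByOptions (node [])      (node [])      _     _    = refl
misereP-determinedByOptions (node [])      (node (_ ∷ _)) _     back with back (here refl)
... | _ , () , _
misereP-determinedByOptions (node (_ ∷ _)) (node [])      forth _    with forth (here refl)
... | _ , () , _
misereP-determinedByOptions (node (_ ∷ _)) (node (_ ∷ _)) forth back =
  ⇔→≡ (mk⇔ (transfer back) (transfer (λ g∈ → let h , h∈ , e = forth g∈ in h , h∈ , sym e)))
  where
  transfer : ∀ {xs ys} → (∀ {y} → y ∈ ys → ∃[ x ] x ∈ xs × misereP x ≡ misereP y) →
             allN xs ≡ true → allN ys ≡ true
  transfer {xs} {ys} corr xs𝒩 = from (allN≡true⇔ ys) (All.tabulate λ y∈ →
    let x , x∈ , e = corr y∈ in trans (sym e) (All.lookup (to (allN≡true⇔ xs) xs𝒩) x∈))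

misereP-≅ : ∀ {G H} → G ≅ H → misereP G ≡ misereP H
misereP-≅ = ≅-invariant misereP misereP-determinedByOptions

o⁻≡𝒫⇔ : ∀ G → o⁻ G ≡ 𝒫 ⇔ misereP G ≡ true
o⁻≡𝒫⇔ G with misereP G
... | true  = mk⇔ (λ _ → refl) (λ _ → refl)
... | false = mk⇔ (λ ()) (λ ())

o⁻-≅ : ∀ {G H} → G ≅ H → o⁻ G ≡ o⁻ H
o⁻-≅ G≅H = cong (λ b → if b then 𝒫 else 𝒩) (misereP-≅ G≅H)

misereP≡true⇒option : ∀ G → misereP G ≡ true → ∃[ g ] g ≺ G
misereP≡true⇒option (node (g ∷ _)) _ = g , here refl

misereP≡false⇒𝒫-option : ∀ G {g} → g ≺ G → misereP G ≡ false → ∃[ g′ ] g′ ≺ G × misereP g′ ≡ true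
misereP≡false⇒𝒫-option (node gs@(_ ∷ _)) _ G𝒩 =
  let g , g≺G , g¬𝒩 = find (¬All⇒Any¬ (λ g → misereP g ≟ᵇ false) gs
                             (λ gs𝒩 → contradiction (trans (sym G𝒩) (from (allN≡true⇔ gs) gs𝒩)) λ ()))
  in g , g≺G , ¬-not g¬𝒩

below-suc : ∀ {l n} → (∀ {j} → j < n → j ∈ l) → n ∈ l → ∀ {j} → j < suc n → j ∈ l
below-suc below n∈l (s≤s j≤n) with m≤n⇒m<n∨m≡n j≤n
... | inj₁ j<n  = below j<n
... | inj₂ refl = n∈l

mexAux-spec : ∀ l n k → (∀ {j} → j < n → j ∈ l) →
  (∀ {j} → j < mexAux l n k → j ∈ l) × (mexAux l n k ∉ l ⊎ mexAux l n k ≡ n + k)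
mexAux-spec l n zero    below = below , inj₂ (sym (+-identityʳ n))
mexAux-spec l n (suc k) below with n ∈? l
... | no  n∉l = below , inj₁ n∉l
... | yes n∈l with mexAux-spec l (suc n) k (below-suc below n∈l)
...   | below′ , inj₁ ∉l      = below′ , inj₁ ∉l
...   | below′ , inj₂ ≡1+n+k = below′ , inj₂ (trans ≡1+n+k (sym (+-suc n k)))

length-bound : ∀ {m} l → (∀ {j} → j < m → j ∈ l) → m ≤ length l
length-bound {m} l below with m ≤? length l
... | yes m≤len = m≤len
... | no  m≰len with pigeonhole (≰⇒> m≰len) (λ i → index (below (toℕ<n i)))
...   | i , j , i<j , same-index =
  contradiction (trans (position i) (trans (cong (lookup l) same-index) (sym (position j)))) (<⇒≢ i<j)
  where
  position : ∀ i → toℕ i ≡ lookup l (index (below (toℕ<n i)))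
  position i = lookup-index (below (toℕ<n i))

-- The fuel 1 + length l of mex never runs out: l cannot contain all of 0, …, length l.
mex-spec : ∀ l → (∀ {j} → j < mex l → j ∈ l) × mex l ∉ l
mex-spec l with mexAux-spec l 0 (suc (length l)) (λ ())
... | below , inj₁ ∉l      = below , ∉l
... | below , inj₂ ≡1+len =
  contradiction (length-bound l (λ j< → below (subst (_ <_) (sym ≡1+len) j<))) (<-irrefl refl)

grundys≡map : ∀ gs → grundys gs ≡ map grundy gs
grundys≡map []       = refl
grundys≡map (g ∷ gs) = cong (grundy g ∷_) (grundys≡map gs)

grundy-option-below : ∀ G {j} → j < grundy G → ∃[ g ] g ≺ G × grundy g ≡ j
grundy-option-below (node gs) j<G
  with ∈-map⁻ grundy (subst (_ ∈_) (grundys≡map gs) (proj₁ (mex-spec (grundys gs)) j<G))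
... | g , g≺G , j≡g = g , g≺G , sym j≡g

grundy-option-≢ : ∀ G {g} → g ≺ G → grundy g ≢ grundy G
grundy-option-≢ (node gs) g≺G g≡G = proj₂ (mex-spec (grundys gs))
  (subst (_∈ grundys gs) g≡G (subst (_ ∈_) (sym (grundys≡map gs)) (∈-map⁺ grundy g≺G)))

grundy-unique : ∀ G r → (∀ {j} → j < r → ∃[ g ] g ≺ G × grundy g ≡ j) →
                (∀ {g} → g ≺ G → grundy g ≢ r) → grundy G ≡ r
grundy-unique G r below ≢r with <-cmp (grundy G) r
... | tri≈ _ G≡r _ = G≡r
... | tri< G<r _ _ = let g , g≺G , g≡G = below G<r in contradiction g≡G (grundy-option-≢ G g≺G)
... | tri> _ _ r<G = let g , g≺G , g≡r = grundy-option-below G r<G in contradiction g≡r (≢r g≺G)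

grundy-determinedByOptions : DeterminedByOptions grundy
grundy-determinedByOptions G H forth back = grundy-unique G (grundy H) below ≢H
  where
  below : ∀ {j} → j < grundy H → ∃[ g ] g ≺ G × grundy g ≡ j
  below j<H = let h , h≺H , h≡j = grundy-option-below H j<H ; g , g≺G , g≡h = back h≺H
              in g , g≺G , trans g≡h h≡j
  ≢H : ∀ {g} → g ≺ G → grundy g ≢ grundy H
  ≢H g≺G g≡H = let h , h≺H , g≡h = forth g≺G in grundy-option-≢ H h≺H (trans (sym g≡h) g≡H)

grundy-≅ : ∀ {G H} → G ≅ H → grundy G ≡ grundy H
grundy-≅ = ≅-invariant grundy grundy-determinedByOptions

grundy≡0 : ∀ G → (∀ {g} → g ≺ G → grundy g ≢ 0) → grundy G ≡ 0
grundy≡0 G ≢0 = grundy-unique G 0 (λ ()) ≢0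

option-grundy≡0⇒grundy≢0 : ∀ G {g} → g ≺ G → grundy g ≡ 0 → grundy G ≢ 0
option-grundy≡0⇒grundy≢0 G g≺G g≡0 G≡0 = grundy-option-≢ G g≺G (trans g≡0 (sym G≡0))

mutual
  ≡⇒⊕-grundy≡0 : ∀ {G H} → Acc _≺_ G → Acc _≺_ H → grundy G ≡ grundy H → grundy (G ⊕ H) ≡ 0
  ≡⇒⊕-grundy≡0 {G} {H} aG@(acc rG) aH@(acc rH) G≡H = grundy≡0 (G ⊕ H) (≢0 ∘ ⊕-view G H)
    where
    ≢0 : ∀ {x} → ⊕-View G H x → grundy x ≢ 0
    ≢0 (left  g≺G) = ≢⇒⊕-grundy≢0 (rG g≺G) aH (λ g≡H → grundy-option-≢ G g≺G (trans g≡H (sym G≡H)))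
    ≢0 (right h≺H) = ≢⇒⊕-grundy≢0 aG (rH h≺H) (λ G≡h → grundy-option-≢ H h≺H (trans (sym G≡h) G≡H))

  -- Move in the component of larger Grundy value to an option with the other's value.
  ≢⇒⊕-grundy≢0 : ∀ {G H} → Acc _≺_ G → Acc _≺_ H → grundy G ≢ grundy H → grundy (G ⊕ H) ≢ 0
  ≢⇒⊕-grundy≢0 {G} {H} aG@(acc rG) aH@(acc rH) G≢H with <-cmp (grundy G) (grundy H)
  ... | tri≈ _ G≡H _ = contradiction G≡H G≢H
  ... | tri< G<H _ _ = let h , h≺H , h≡G = grundy-option-below H G<H in
    option-grundy≡0⇒grundy≢0 (G ⊕ H) (≺-⊕ʳ G H h≺H) (≡⇒⊕-grundy≡0 aG (rH h≺H) (sym h≡G))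
  ... | tri> _ _ H<G = let g , g≺G , g≡H = grundy-option-below G H<G in
    option-grundy≡0⇒grundy≢0 (G ⊕ H) (≺-⊕ˡ G H g≺G) (≡⇒⊕-grundy≡0 (rG g≺G) aH g≡H)

⊕-grundy≡0⇔ : ∀ G H → grundy (G ⊕ H) ≡ 0 ⇔ grundy G ≡ grundy H
⊕-grundy≡0⇔ G H = mk⇔
  (λ G⊕H≡0 → decidable-stable (grundy G ≟ grundy H) (λ G≢H → ≢⇒⊕-grundy≢0 aG aH G≢H G⊕H≡0))
  (≡⇒⊕-grundy≡0 aG aH)
  where
  aG = ≺-wellFounded G
  aH = ≺-wellFounded H

grundy-⊕-cancelʳ : ∀ G H Y → grundy (G ⊕ Y) ≡ grundy (H ⊕ Y) ⇔ grundy G ≡ grundy H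
grundy-⊕-cancelʳ G H Y = begin
  grundy (G ⊕ Y) ≡ grundy (H ⊕ Y)         ≈⟨ ⊕-grundy≡0⇔ (G ⊕ Y) (H ⊕ Y) ⟨
  grundy ((G ⊕ Y) ⊕ (H ⊕ Y)) ≡ 0          ≈⟨ ≡-resp-⇔ (grundy-≅ (⊕-interchange G Y H Y)) refl ⟩
  grundy ((G ⊕ H) ⊕ (Y ⊕ Y)) ≡ 0          ≈⟨ ⊕-grundy≡0⇔ (G ⊕ H) (Y ⊕ Y) ⟩
  grundy (G ⊕ H) ≡ grundy (Y ⊕ Y)         ≈⟨ ≡-resp-⇔ refl (from (⊕-grundy≡0⇔ Y Y) refl) ⟩
  grundy (G ⊕ H) ≡ 0                      ≈⟨ ⊕-grundy≡0⇔ G H ⟩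
  grundy G ≡ grundy H                     ∎
  where open SetoidReasoning (⇔-setoid 0ℓ)

module FiniteCommutativeMonoid {n} {_·_ : Op₂ (Fin n)} {ε : Fin n}
                               (isCommutativeMonoid : IsCommutativeMonoid _≡_ _·_ ε) where

  open IsCommutativeMonoid isCommutativeMonoid using (assoc; comm; identityʳ)
  open ≡-Reasoning

  commutativeMonoid : CommutativeMonoid 0ℓ 0ℓ
  commutativeMonoid = record { isCommutativeMonoid = isCommutativeMonoid }

  open CommutativeSemigroupProperties (CommutativeMonoid.commutativeSemigroup commutativeMonoid)
    using (interchange; xy∙z≈xz∙y; xy∙z≈zx∙y)
  open MonoidMult (CommutativeMonoid.monoid commutativeMonoid)
    using (×-homo-+) renaming (_×_ to _times_)
  open Algebra.Definitions (_≡_ {A = Fin n}) using (_IdempotentOn_)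

  infixr 30 _^_

  _^_ : Fin n → ℕ → Fin n
  x ^ m = m times x

  -- Verbatim the definitions of MisereQuotient, so that the two agree definitionally.
  _∣_ : Fin n → Fin n → Set
  x ∣ y = ∃[ w ] (x · w) ≡ y

  z : Fin n
  z = foldr _·_ ε (filter (λ e → (e · e) ≟F e) (allFin n))

  𝒦 : Fin n → Set
  𝒦 x = (x ∣ z) × (z ∣ x)

  ^-periodic : ∀ x a d → x ^ (a + d) ≡ x ^ a → ∀ k → x ^ (a + k * d) ≡ x ^ a
  ^-periodic x a d period zero    = cong (x ^_) (+-identityʳ a)
  ^-periodic x a d period (suc k) = begin
    x ^ (a + (d + k * d))      ≡⟨ cong (x ^_) (+-assoc a d (k * d)) ⟨
    x ^ (a + d + k * d)        ≡⟨ ×-homo-+ x (a + d) (k * d) ⟩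
    x ^ (a + d) · x ^ (k * d)  ≡⟨ cong (_· x ^ (k * d)) period ⟩
    x ^ a · x ^ (k * d)        ≡⟨ ×-homo-+ x a (k * d) ⟨
    x ^ (a + k * d)            ≡⟨ ^-periodic x a d period k ⟩
    x ^ a                      ∎

  -- a * suc d is past the threshold a of the periodicity and a multiple of the period suc d.
  ^-idempotent : ∀ x a d → x ^ (a + suc d) ≡ x ^ a → _·_ IdempotentOn (x ^ (a * suc d))
  ^-idempotent x a d period = begin
    x ^ (a * suc d) · x ^ (a * suc d)          ≡⟨ cong (λ m → x ^ m · x ^ (a * suc d)) (*-suc a d) ⟩
    x ^ (a + a * d) · x ^ (a * suc d)          ≡⟨ cong (_· x ^ (a * suc d)) (×-homo-+ x a (a * d)) ⟩
    (x ^ a · x ^ (a * d)) · x ^ (a * suc d)    ≡⟨ xy∙z≈xz∙y (x ^ a) (x ^ (a * d)) (x ^ (a * suc d)) ⟩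
    (x ^ a · x ^ (a * suc d)) · x ^ (a * d)    ≡⟨ cong (_· x ^ (a * d)) (×-homo-+ x a (a * suc d)) ⟨
    x ^ (a + a * suc d) · x ^ (a * d)          ≡⟨ cong (_· x ^ (a * d)) (^-periodic x a (suc d) period a) ⟩
    x ^ a · x ^ (a * d)                        ≡⟨ ×-homo-+ x a (a * d) ⟨
    x ^ (a + a * d)                            ≡⟨ cong (x ^_) (*-suc a d) ⟨
    x ^ (a * suc d)                            ∎

  divides-idempotent : ∀ x → ∃[ w ] _·_ IdempotentOn (x · w)
  divides-idempotent x with pigeonhole (n<1+n n) (λ i → x ^ suc (toℕ i))
  ... | i , j , i<j , xⁱ≡xʲ with m≤n⇒∃[o]m+o≡n i<j
  ...   | d , i+d≡j = x ^ (d + toℕ i * suc d) , ^-idempotent x (suc (toℕ i)) d period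
    where
    period : x ^ (suc (toℕ i) + suc d) ≡ x ^ suc (toℕ i)
    period = trans (cong (λ m → x ^ suc m) (trans (+-suc (toℕ i) d) i+d≡j)) (sym xⁱ≡xʲ)

  foldr-idempotent : ∀ es → All (_·_ IdempotentOn_) es → _·_ IdempotentOn foldr _·_ ε es
  foldr-idempotent []       []            = identityʳ ε
  foldr-idempotent (e ∷ es) (ee≡e ∷ idem) = begin
    (e · p) · (e · p)  ≡⟨ interchange e p e p ⟩
    (e · e) · (p · p)  ≡⟨ cong₂ _·_ ee≡e (foldr-idempotent es idem) ⟩
    e · p              ∎
    where p = foldr _·_ ε es

  foldr-absorbs : ∀ {e} es → e ∈ es → _·_ IdempotentOn e → (foldr _·_ ε es · e) ≡ foldr _·_ ε es
  foldr-absorbs {e} (e ∷ es) (here refl) ee≡e = begin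
    (e · p) · e  ≡⟨ xy∙z≈xz∙y e p e ⟩
    (e · e) · p  ≡⟨ cong (_· p) ee≡e ⟩
    e · p        ∎
    where p = foldr _·_ ε es
  foldr-absorbs {e} (e′ ∷ es) (there e∈es) ee≡e =
    trans (assoc e′ (foldr _·_ ε es) e) (cong (e′ ·_) (foldr-absorbs es e∈es ee≡e))

  z-idempotent : _·_ IdempotentOn z
  z-idempotent = foldr-idempotent _ (all-filter (λ e → (e · e) ≟F e) (allFin n))

  z-absorbs : ∀ {e} → _·_ IdempotentOn e → (z · e) ≡ z
  z-absorbs {e} ee≡e = foldr-absorbs _ (∈-filter⁺ (λ e → (e · e) ≟F e) (∈-allFin e) ee≡e) ee≡e

  𝒦-identity : ∀ {x} → 𝒦 x → (z · x) ≡ x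
  𝒦-identity {x} (_ , w , zw≡x) = begin
    z · x        ≡⟨ cong (z ·_) zw≡x ⟨
    z · (z · w)  ≡⟨ assoc z z w ⟨
    (z · z) · w  ≡⟨ cong (_· w) z-idempotent ⟩
    z · w        ≡⟨ zw≡x ⟩
    x            ∎

  z·x∈𝒦 : ∀ x → 𝒦 (z · x)
  z·x∈𝒦 x with divides-idempotent x
  ... | w , idem = (w , trans (assoc z x w) (z-absorbs idem)) , (x , refl)

  𝒦-·ʳ : ∀ {k} y → 𝒦 k → 𝒦 (k · y)
  𝒦-·ʳ {k} y k∈𝒦 =
    subst 𝒦 (trans (sym (assoc z k y)) (cong (_· y) (𝒦-identity k∈𝒦))) (z·x∈𝒦 (k · y))

  𝒦-·ˡ : ∀ {k} y → 𝒦 k → 𝒦 (y · k)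
  𝒦-·ˡ {k} y k∈𝒦 = subst 𝒦 (comm k y) (𝒦-·ʳ y k∈𝒦)

  𝒦-cancelʳ : ∀ {x y c} → 𝒦 x → 𝒦 y → c ∣ z → (x · c) ≡ (y · c) → x ≡ y
  𝒦-cancelʳ {x} {y} {c} x∈𝒦 y∈𝒦 (c⁻ , cc⁻≡z) xc≡yc = begin
    x              ≡⟨ 𝒦-identity x∈𝒦 ⟨
    z · x          ≡⟨ cong (_· x) cc⁻≡z ⟨
    (c · c⁻) · x   ≡⟨ xy∙z≈zx∙y c c⁻ x ⟩
    (x · c) · c⁻   ≡⟨ cong (_· c⁻) xc≡yc ⟩
    (y · c) · c⁻   ≡⟨ xy∙z≈zx∙y c c⁻ y ⟨
    (c · c⁻) · y   ≡⟨ cong (_· y) cc⁻≡z ⟩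
    z · y          ≡⟨ 𝒦-identity y∈𝒦 ⟩
    y              ∎

module Quotient {𝒜 : Game → Set} (closed : Closed 𝒜) {n} (Q : MisereQuotient 𝒜 n) where

  open Closed closed
  open MisereQuotient Q
  open Algebra.Definitions (_≡_ {A = Fin n}) using (Commutative; Associative)
  open ≡-Reasoning

  Φ-≅ : ∀ {G H} (a : 𝒜 G) (b : 𝒜 H) → G ≅ H → Φ G a ≡ Φ H b
  Φ-≅ {G} {H} a b G≅H = Φ-kernel← G H a b (λ X _ → o⁻-≅ (⊕-cong G≅H (≅-refl X)))

  Φ-⊕ : ∀ {G H} (a : 𝒜 G) (b : 𝒜 H) → Φ (G ⊕ H) (sum-closed a b) ≡ Φ G a · Φ H b
  Φ-⊕ a b = Φ-hom _ _ a b (sum-closed a b)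

  ·-comm : Commutative _·_
  ·-comm x y with Φ-surj x | Φ-surj y
  ... | G , a , refl | H , b , refl = begin
    Φ G a · Φ H b                ≡⟨ Φ-⊕ a b ⟨
    Φ (G ⊕ H) (sum-closed a b)  ≡⟨ Φ-≅ _ _ (⊕-comm G H) ⟩
    Φ (H ⊕ G) (sum-closed b a)  ≡⟨ Φ-⊕ b a ⟩
    Φ H b · Φ G a                ∎

  ·-assoc : Associative _·_
  ·-assoc x y w with Φ-surj x | Φ-surj y | Φ-surj w
  ... | G , a , refl | H , b , refl | K , c , refl = begin
    (Φ G a · Φ H b) · Φ K c                              ≡⟨ cong (_· Φ K c) (Φ-⊕ a b) ⟨
    Φ (G ⊕ H) (sum-closed a b) · Φ K c                   ≡⟨ Φ-⊕ (sum-closed a b) c ⟨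
    Φ ((G ⊕ H) ⊕ K) (sum-closed (sum-closed a b) c)      ≡⟨ Φ-≅ _ _ (⊕-assoc G H K) ⟩
    Φ (G ⊕ (H ⊕ K)) (sum-closed a (sum-closed b c))      ≡⟨ Φ-⊕ a (sum-closed b c) ⟩
    Φ G a · Φ (H ⊕ K) (sum-closed b c)                   ≡⟨ cong (Φ G a ·_) (Φ-⊕ b c) ⟩
    Φ G a · (Φ H b · Φ K c)                              ∎

  ·-isCommutativeMonoid : IsCommutativeMonoid _≡_ _·_ ε
  ·-isCommutativeMonoid = isCommutativeMonoidˡ record
    { isSemigroup = record
      { isMagma = record { isEquivalence = isEquivalence ; ∙-cong = cong₂ _·_ }
      ; assoc   = ·-assoc }
    ; identityˡ = ε-identity
    ; comm      = ·-comm }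

  open FiniteCommutativeMonoid ·-isCommutativeMonoid public
    using (𝒦-identity; z·x∈𝒦; 𝒦-·ʳ; 𝒦-·ˡ; 𝒦-cancelʳ)

  Φ-⊕-z : ∀ {G W} (a : 𝒜 G) (w : 𝒜 W) → Φ W w ≡ z → Φ (G ⊕ W) (sum-closed a w) ≡ z · Φ G a
  Φ-⊕-z a w W↦z = trans (Φ-⊕ a w) (trans (cong (Φ _ a ·_) W↦z) (·-comm _ z))

  sum-options-∈𝒦 : ∀ {G H} (a : 𝒜 G) (b : 𝒜 H) → 𝒦 (Φ G a) → 𝒦 (Φ H b) →
                   ∀ {y} → y ≺ G ⊕ H → (c : 𝒜 y) → 𝒦 (Φ y c)
  sum-options-∈𝒦 {G} {H} a b G∈𝒦 H∈𝒦 y≺G⊕H c with ⊕-view G H y≺G⊕H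
  ... | left  g≺G = subst 𝒦 (sym (Φ-hom _ _ (option-closed a g≺G) b c)) (𝒦-·ˡ _ H∈𝒦)
  ... | right h≺H = subst 𝒦 (sym (Φ-hom _ _ a (option-closed b h≺H) c)) (𝒦-·ʳ _ G∈𝒦)

  module FaithfulRegular (faithful : Faithful)
                         {T : Game} (T∈𝒜 : 𝒜 T) (T-𝒫 : o⁻ T ≡ 𝒫) (ΦT∈𝒦 : 𝒦 (Φ T T∈𝒜))
                         (𝒦∩𝓟⇒≡ΦT : ∀ k → 𝒦 k → 𝓟 k → k ≡ Φ T T∈𝒜) where

    𝒦-options⇒𝒫 : ∀ {X} (x : 𝒜 X) → ∃[ y ] y ≺ X → (∀ {y} → y ≺ X → (c : 𝒜 y) → 𝒦 (Φ y c)) →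
                  grundy X ≡ grundy T → misereP X ≡ true
    𝒦-options⇒𝒫 {X} x (_ , g≺X) options∈𝒦 X~T with misereP X in X-misere
    ... | true  = refl
    ... | false with misereP≡false⇒𝒫-option X g≺X X-misere
    ...   | y , y≺X , y-𝒫 = contradiction (trans y~T (sym X~T)) (grundy-option-≢ X y≺X)
      where
      c = option-closed x y≺X
      y~T : grundy y ≡ grundy T
      y~T = faithful _ _ c T∈𝒜 (𝒦∩𝓟⇒≡ΦT _ (options∈𝒦 y≺X c) (y , c , refl , from (o⁻≡𝒫⇔ y) y-𝒫))

    grundy-T⇒Φ≡ΦT : ∀ {X} (x : 𝒜 X) → 𝒦 (Φ X x) → ∃[ y ] y ≺ X →
                    (∀ {y} → y ≺ X → (c : 𝒜 y) → 𝒦 (Φ y c)) → grundy X ≡ grundy T → Φ X x ≡ Φ T T∈𝒜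
    grundy-T⇒Φ≡ΦT {X} x X∈𝒦 option options∈𝒦 X~T =
      𝒦∩𝓟⇒≡ΦT _ X∈𝒦 (X , x , refl , from (o⁻≡𝒫⇔ X) (𝒦-options⇒𝒫 x option options∈𝒦 X~T))

    -- Add to both games some Y with Φ (X′ ⊕ Y) = Φ T, built from a copy of T so that X ⊕ Y has
    -- options; then both sums map to Φ T, and Φ Y cancels in the group 𝒦.
    Φ-injective-on-𝒦 : ∀ {X X′} (x : 𝒜 X) (x′ : 𝒜 X′) → 𝒦 (Φ X x) → 𝒦 (Φ X′ x′) →
                       grundy X ≡ grundy X′ → Φ X x ≡ Φ X′ x′
    Φ-injective-on-𝒦 {X} {X′} x x′ X∈𝒦 X′∈𝒦 X~X′ with proj₁ X′∈𝒦
    ... | k , X′·U≡z with Φ-surj k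
    ...   | U , u , refl = 𝒦-cancelʳ X∈𝒦 X′∈𝒦 (proj₁ Y∈𝒦) (begin
      Φ X x · Φ Y y                 ≡⟨ Φ-⊕ x y ⟨
      Φ (X ⊕ Y) (sum-closed x y)    ≡⟨ X⊕Y↦ΦT ⟩
      ΦT                            ≡⟨ X′⊕Y↦ΦT ⟨
      Φ (X′ ⊕ Y) (sum-closed x′ y)  ≡⟨ Φ-⊕ x′ y ⟩
      Φ X′ x′ · Φ Y y               ∎)
      where
      ΦT = Φ T T∈𝒜
      Y = U ⊕ T
      y = sum-closed u T∈𝒜

      Y∈𝒦 : 𝒦 (Φ Y y)
      Y∈𝒦 = subst 𝒦 (sym (Φ-⊕ u T∈𝒜)) (𝒦-·ˡ _ ΦT∈𝒦)

      X′⊕Y↦ΦT : Φ (X′ ⊕ Y) (sum-closed x′ y) ≡ ΦT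
      X′⊕Y↦ΦT = begin
        Φ (X′ ⊕ Y) (sum-closed x′ y)  ≡⟨ Φ-⊕ x′ y ⟩
        Φ X′ x′ · Φ Y y               ≡⟨ cong (Φ X′ x′ ·_) (Φ-⊕ u T∈𝒜) ⟩
        Φ X′ x′ · (Φ U u · ΦT)        ≡⟨ ·-assoc _ _ _ ⟨
        (Φ X′ x′ · Φ U u) · ΦT        ≡⟨ cong (_· ΦT) X′·U≡z ⟩
        z · ΦT                        ≡⟨ 𝒦-identity ΦT∈𝒦 ⟩
        ΦT                            ∎

      X⊕Y~T : grundy (X ⊕ Y) ≡ grundy T
      X⊕Y~T = trans (from (grundy-⊕-cancelʳ X X′ Y) X~X′) (faithful _ _ _ T∈𝒜 X′⊕Y↦ΦT)

      X⊕Y-option : ∃[ w ] w ≺ X ⊕ Y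
      X⊕Y-option = let t , t≺T = misereP≡true⇒option T (to (o⁻≡𝒫⇔ T) T-𝒫)
                   in X ⊕ (U ⊕ t) , ≺-⊕ʳ X Y (≺-⊕ʳ U T t≺T)

      X⊕Y↦ΦT : Φ (X ⊕ Y) (sum-closed x y) ≡ ΦT
      X⊕Y↦ΦT = grundy-T⇒Φ≡ΦT (sum-closed x y) (subst 𝒦 (sym (Φ-⊕ x y)) (𝒦-·ʳ _ X∈𝒦))
                              X⊕Y-option (sum-options-∈𝒦 x y X∈𝒦 Y∈𝒦) X⊕Y~T

theorem6p4 : (𝒜 : Game → Set) → Closed 𝒜 → (n : ℕ) → (Q : MisereQuotient 𝒜 n) →
    MisereQuotient.Regular Q → MisereQuotient.Faithful Q →
    ∀ G H (a : 𝒜 G) (b : 𝒜 H) →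
      let open MisereQuotient Q in
      ((z · Φ G a) ≡ (z · Φ H b)) ⇔ (grundy G ≡ grundy H)
theorem6p4 𝒜 closed n Q (_ , (p∈𝒦 , T , T∈𝒜 , refl , T-𝒫) , unique) faithful G H a b
  with MisereQuotient.Φ-surj Q (MisereQuotient.z Q)
... | W , w , W↦z = begin
  z · Φ G a ≡ z · Φ H b
    ≈⟨ ≡-resp-⇔ (Φ-⊕-z a w W↦z) (Φ-⊕-z b w W↦z) ⟨
  Φ (G ⊕ W) (sum-closed a w) ≡ Φ (H ⊕ W) (sum-closed b w)
    ≈⟨ mk⇔ (faithful _ _ _ _) (Φ-injective-on-𝒦 _ _ (⊕W∈𝒦 a) (⊕W∈𝒦 b)) ⟩
  grundy (G ⊕ W) ≡ grundy (H ⊕ W)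
    ≈⟨ grundy-⊕-cancelʳ G H W ⟩
  grundy G ≡ grundy H
    ∎
  where
  open MisereQuotient Q
  open Closed closed
  open Quotient closed Q
  open FaithfulRegular faithful T∈𝒜 T-𝒫 p∈𝒦 unique
  open SetoidReasoning (⇔-setoid 0ℓ)

  ⊕W∈𝒦 : ∀ {G} (a : 𝒜 G) → 𝒦 (Φ (G ⊕ W) (sum-closed a w))
  ⊕W∈𝒦 a = subst 𝒦 (sym (Φ-⊕-z a w W↦z)) (z·x∈𝒦 _)
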